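{- Let $A$ be an MV-monoidal algebra. Addition of good sequences in $A$ is associative: for all good sequences $\mathbf a,\mathbf b,\mathbf c$ in $A$, $(\mathbf a+\mathbf b)+\mathbf c=\mathbf a+(\mathbf b+\mathbf c)$.
   Context: An MV-monoidal algebra is an algebra $\langle A;\oplus,\odot,\vee,\wedge,0,1\rangle$ satisfying: $\langle A;\vee,\wedge\rangle$ is a distributive lattice; $\langle A;\oplus,0\rangle$ and $\langle A;\odot,1\rangle$ are commutative monoids; $\oplus$ and $\odot$ both distribute over both $\vee$ and $\wedge$; $(x\oplus y)\odot((x\odot y)\oplus z)=(x\odot(y\oplus z))\oplus(y\odot z)$; $(x\odot y)\oplus((x\oplus y)\odot z)=(x\oplus(y\odot z))\odot(y\oplus z)$; $(x\odot y)\oplus z=((x\oplus y)\odot((x\odot y)\oplus z))\vee z$; $(x\oplus y)\odot z=((x\odot y)\oplus((x\oplus y)\odot z))\wedge z$. A good pair is $(x_0,x_1)$ with $x_0\oplus x_1=x_0$ and $x_0\odot x_1=x_1$; a good sequence is a sequence in $A$, eventually $0$, in which every two consecutive terms form a good pair. The sum of good sequences $\mathbf a=(a_0,a_1,\dots)$ and $\mathbf b=(b_0,b_1,\dots)$ is the (good) sequence $\mathbf a+\mathbf b$ with $n$-th term $(a_0\oplus b_n)\odot(a_1\oplus b_{n-1})\odot\dots\odot(a_n\oplus b_0)$. -}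

module Defs where

open import Level using (Level; suc; _⊔_)
open import Data.Nat using (ℕ; zero; _≤_; _∸_) renaming (suc to sucℕ)
open import Data.Product using (Σ; _×_; ∃)
open import Relation.Binary.PropositionalEquality using (_≡_)

record MVMonoidalAlgebra (a : Level) : Set (suc a) where
  infixl 6 _⊕_
  infixl 7 _⊙_
  infixl 5 _∨_
  infixl 5 _∧_
  field
    Carrier : Set a
    _⊕_ _⊙_ _∨_ _∧_ : Carrier → Carrier → Carrier
    𝟘 𝟙 : Carrier
    ∨-comm   : ∀ x y → x ∨ y ≡ y ∨ x
    ∧-comm   : ∀ x y → x ∧ y ≡ y ∧ x
    ∨-assoc  : ∀ x y z → (x ∨ y) ∨ z ≡ x ∨ (y ∨ z)
    ∧-assoc  : ∀ x y z → (x ∧ y) ∧ z ≡ x ∧ (y ∧ z)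
    ∨-absorbs-∧ : ∀ x y → x ∨ (x ∧ y) ≡ x
    ∧-absorbs-∨ : ∀ x y → x ∧ (x ∨ y) ≡ x
    ∧-distribˡ-∨ : ∀ x y z → x ∧ (y ∨ z) ≡ (x ∧ y) ∨ (x ∧ z)
    ⊕-comm      : ∀ x y → x ⊕ y ≡ y ⊕ x
    ⊕-assoc     : ∀ x y z → (x ⊕ y) ⊕ z ≡ x ⊕ (y ⊕ z)
    ⊕-identityʳ : ∀ x → x ⊕ 𝟘 ≡ x
    ⊙-comm      : ∀ x y → x ⊙ y ≡ y ⊙ x
    ⊙-assoc     : ∀ x y z → (x ⊙ y) ⊙ z ≡ x ⊙ (y ⊙ z)
    ⊙-identityʳ : ∀ x → x ⊙ 𝟙 ≡ x
    ⊕-distrib-∨ : ∀ x y z → x ⊕ (y ∨ z) ≡ (x ⊕ y) ∨ (x ⊕ z)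
    ⊕-distrib-∧ : ∀ x y z → x ⊕ (y ∧ z) ≡ (x ⊕ y) ∧ (x ⊕ z)
    ⊙-distrib-∨ : ∀ x y z → x ⊙ (y ∨ z) ≡ (x ⊙ y) ∨ (x ⊙ z)
    ⊙-distrib-∧ : ∀ x y z → x ⊙ (y ∧ z) ≡ (x ⊙ y) ∧ (x ⊙ z)
    ax1 : ∀ x y z → (x ⊕ y) ⊙ ((x ⊙ y) ⊕ z) ≡ (x ⊙ (y ⊕ z)) ⊕ (y ⊙ z)
    ax2 : ∀ x y z → (x ⊙ y) ⊕ ((x ⊕ y) ⊙ z) ≡ (x ⊕ (y ⊙ z)) ⊙ (y ⊕ z)
    ax3 : ∀ x y z → (x ⊙ y) ⊕ z ≡ ((x ⊕ y) ⊙ ((x ⊙ y) ⊕ z)) ∨ z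
    ax4 : ∀ x y z → (x ⊕ y) ⊙ z ≡ ((x ⊙ y) ⊕ ((x ⊕ y) ⊙ z)) ∧ z

module _ {a : Level} (A : MVMonoidalAlgebra a) where
  open MVMonoidalAlgebra A

  GoodPair : Carrier → Carrier → Set a
  GoodPair x₀ x₁ = (x₀ ⊕ x₁ ≡ x₀) × (x₀ ⊙ x₁ ≡ x₁)

  IsGoodSeq : (ℕ → Carrier) → Set a
  IsGoodSeq s = (∀ n → GoodPair (s n) (s (sucℕ n)))
              × (Σ ℕ λ N → ∀ n → N ≤ n → s n ≡ 𝟘)

  record GoodSeq : Set a where
    constructor mkGoodSeq
    field
      seq    : ℕ → Carrier
      isGood : IsGoodSeq seq

  prodUpTo : (ℕ → Carrier) → ℕ → Carrier
  prodUpTo f zero     = f zero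
  prodUpTo f (sucℕ n) = prodUpTo f n ⊙ f (sucℕ n)

  seqSum : (ℕ → Carrier) → (ℕ → Carrier) → ℕ → Carrier
  seqSum s t n = prodUpTo (λ i → s i ⊕ t (n ∸ i)) n

  _≗ₛ_ : (ℕ → Carrier) → (ℕ → Carrier) → Set a
  s ≗ₛ t = ∀ n → s n ≡ t n

module Submission where

-- Write (y) for the sequence y, 0, 0, …. A good sequence a splits as (a₁, a₂, …) + (a₀),
-- so associativity follows by induction on the length of a once one knows that adding a
-- one-term sequence commutes with adding a good sequence: (p + (y)) + q = (p + q) + (y).
-- Both sides have n-th term (p + q)ₙ ⊕ (p + q)ₙ₋₁ ⊙ y, reading (p + q)₋₁ as 1. For the
-- left side this is proved by induction along the partial products defining the n-th
-- term; there the axioms are only ever used on good pairs, where they become exchange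
-- laws such as u ⊙ (v ⊕ x) = v ⊕ u ⊙ x.

open import Level using (Level)
open import Defs
open import Algebra.Core using (Op₂)
open import Algebra.Bundles using (CommutativeSemigroup)
open import Algebra.Lattice.Bundles using (Lattice)
import Algebra.Lattice.Properties.Lattice as LatticeProperties
import Algebra.Properties.CommutativeSemigroup as CommutativeSemigroupProperties
import Relation.Binary.Lattice as OrderLattice
open import Relation.Binary.Bundles using (Poset)
import Relation.Binary.Reasoning.PartialOrder as PosetReasoning
open import Data.Nat using (ℕ; zero; suc; _∸_; z≤n; s≤s) renaming (_≤_ to _≤ℕ_)
import Data.Nat.Properties as ℕ
open import Data.Product using (_,_; proj₁; proj₂)
open import Relation.Binary.PropositionalEquality
  using (_≡_; refl; sym; trans; cong; cong₂; subst; subst₂; _≗_; isEquivalence; module ≡-Reasoning)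

module _ {ℓ : Level} (A : MVMonoidalAlgebra ℓ) where
  open MVMonoidalAlgebra A

  lattice : Lattice ℓ ℓ
  lattice = record
    { isLattice = record
      { isEquivalence = isEquivalence
      ; ∨-comm        = ∨-comm
      ; ∨-assoc       = ∨-assoc
      ; ∨-cong        = cong₂ _∨_
      ; ∧-comm        = ∧-comm
      ; ∧-assoc       = ∧-assoc
      ; ∧-cong        = cong₂ _∧_
      ; absorptive    = ∨-absorbs-∧ , ∧-absorbs-∨
      }
    }

  open LatticeProperties lattice using (poset; ∨-∧-orderTheoreticLattice)
  -- x ≤ y unfolds to x ≡ x ∧ y, which the monotonicity proofs below use directly.
  open Poset poset using (_≤_)
    renaming (refl to ≤-refl; reflexive to ≤-reflexive; trans to ≤-trans; antisym to ≤-antisym)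
  open OrderLattice.Lattice ∨-∧-orderTheoreticLattice using (y≤x∨y; x∧y≤y; ∨-least)
  module ≤-Reasoning = PosetReasoning poset

  commutativeSemigroup : (_∙_ : Op₂ Carrier) →
    (∀ x y z → (x ∙ y) ∙ z ≡ x ∙ (y ∙ z)) → (∀ x y → x ∙ y ≡ y ∙ x) → CommutativeSemigroup ℓ ℓ
  commutativeSemigroup _∙_ assoc comm = record
    { isCommutativeSemigroup = record
      { isSemigroup = record
        { isMagma = record { isEquivalence = isEquivalence ; ∙-cong = cong₂ _∙_ }
        ; assoc   = assoc
        }
      ; comm = comm
      }
    }

  module ⊕ = CommutativeSemigroupProperties (commutativeSemigroup _⊕_ ⊕-assoc ⊕-comm)
  module ⊙ = CommutativeSemigroupProperties (commutativeSemigroup _⊙_ ⊙-assoc ⊙-comm)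

  ⊕-monoʳ-≤ : ∀ x {y z} → y ≤ z → x ⊕ y ≤ x ⊕ z
  ⊕-monoʳ-≤ x {y} {z} y≤z = trans (cong (x ⊕_) y≤z) (⊕-distrib-∧ x y z)

  ⊙-monoʳ-≤ : ∀ x {y z} → y ≤ z → x ⊙ y ≤ x ⊙ z
  ⊙-monoʳ-≤ x {y} {z} y≤z = trans (cong (x ⊙_) y≤z) (⊙-distrib-∧ x y z)

  ⊕-monoˡ-≤ : ∀ x {y z} → y ≤ z → y ⊕ x ≤ z ⊕ x
  ⊕-monoˡ-≤ x {y} {z} y≤z = subst₂ _≤_ (⊕-comm x y) (⊕-comm x z) (⊕-monoʳ-≤ x y≤z)

  ⊙-monoˡ-≤ : ∀ x {y z} → y ≤ z → y ⊙ x ≤ z ⊙ x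
  ⊙-monoˡ-≤ x {y} {z} y≤z = subst₂ _≤_ (⊙-comm x y) (⊙-comm x z) (⊙-monoʳ-≤ x y≤z)

  ⊙-mono-≤ : ∀ {w x y z} → w ≤ x → y ≤ z → w ⊙ y ≤ x ⊙ z
  ⊙-mono-≤ {x = x} {y} w≤x y≤z = ≤-trans (⊙-monoˡ-≤ y w≤x) (⊙-monoʳ-≤ x y≤z)

  ⊕-identityˡ : ∀ x → 𝟘 ⊕ x ≡ x
  ⊕-identityˡ x = trans (⊕-comm 𝟘 x) (⊕-identityʳ x)

  ⊙-identityˡ : ∀ x → 𝟙 ⊙ x ≡ x
  ⊙-identityˡ x = trans (⊙-comm 𝟙 x) (⊙-identityʳ x)

  𝟘-minimum : ∀ x → 𝟘 ≤ x
  𝟘-minimum x = begin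
    𝟘                                ≤⟨ y≤x∨y _ 𝟘 ⟩
    (x ⊕ 𝟙) ⊙ (x ⊙ 𝟙 ⊕ 𝟘) ∨ 𝟘       ≡⟨ ax3 x 𝟙 𝟘 ⟨
    x ⊙ 𝟙 ⊕ 𝟘                        ≡⟨ trans (⊕-identityʳ _) (⊙-identityʳ x) ⟩
    x                                ∎
    where open ≤-Reasoning

  𝟙-maximum : ∀ x → x ≤ 𝟙
  𝟙-maximum x = begin
    x                                ≡⟨ trans (⊙-identityʳ _) (⊕-identityʳ x) ⟨
    (x ⊕ 𝟘) ⊙ 𝟙                      ≡⟨ ax4 x 𝟘 𝟙 ⟩
    (x ⊙ 𝟘 ⊕ (x ⊕ 𝟘) ⊙ 𝟙) ∧ 𝟙       ≤⟨ x∧y≤y _ 𝟙 ⟩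
    𝟙                                ∎
    where open ≤-Reasoning

  x⊙y≤x : ∀ x y → x ⊙ y ≤ x
  x⊙y≤x x y = ≤-trans (⊙-monoʳ-≤ x (𝟙-maximum y)) (≤-reflexive (⊙-identityʳ x))

  x⊙y≤y : ∀ x y → x ⊙ y ≤ y
  x⊙y≤y x y = subst (_≤ y) (⊙-comm y x) (x⊙y≤x y x)

  x≤x⊕y : ∀ x y → x ≤ x ⊕ y
  x≤x⊕y x y = ≤-trans (≤-reflexive (sym (⊕-identityʳ x))) (⊕-monoʳ-≤ x (𝟘-minimum y))

  y≤x⊕y : ∀ x y → y ≤ x ⊕ y
  y≤x⊕y x y = subst (y ≤_) (⊕-comm y x) (x≤x⊕y y x)

  ⊕-zeroˡ : ∀ x → 𝟙 ⊕ x ≡ 𝟙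
  ⊕-zeroˡ x = ≤-antisym (𝟙-maximum _) (x≤x⊕y 𝟙 x)

  x≤y⇒x∨y≡y : ∀ {x y} → x ≤ y → x ∨ y ≡ y
  x≤y⇒x∨y≡y {x} {y} x≤y = ≤-antisym (∨-least x≤y ≤-refl) (y≤x∨y x y)

  ∨-identityʳ : ∀ x → x ∨ 𝟘 ≡ x
  ∨-identityʳ x = trans (∨-comm x 𝟘) (x≤y⇒x∨y≡y (𝟘-minimum x))

  ⊙-⊕-weakDistrib : ∀ x y z → x ⊙ (y ⊕ z) ≤ x ⊙ y ⊕ z
  ⊙-⊕-weakDistrib x y z = begin
    x ⊙ (y ⊕ z)                      ≤⟨ x≤x⊕y _ (y ⊙ z) ⟩
    x ⊙ (y ⊕ z) ⊕ y ⊙ z              ≡⟨ ax1 x y z ⟨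
    (x ⊕ y) ⊙ (x ⊙ y ⊕ z)            ≤⟨ x⊙y≤y _ _ ⟩
    x ⊙ y ⊕ z                        ∎
    where open ≤-Reasoning

  ⊙-⊕-mixed-comm : ∀ x y z → x ⊙ y ⊕ (x ⊕ y) ⊙ z ≡ x ⊙ z ⊕ (x ⊕ z) ⊙ y
  ⊙-⊕-mixed-comm x y z = begin
    x ⊙ y ⊕ (x ⊕ y) ⊙ z              ≡⟨ ax2 x y z ⟩
    (x ⊕ y ⊙ z) ⊙ (y ⊕ z)            ≡⟨ cong₂ (λ a b → (x ⊕ a) ⊙ b) (⊙-comm y z) (⊕-comm y z) ⟩
    (x ⊕ z ⊙ y) ⊙ (z ⊕ y)            ≡⟨ ax2 x z y ⟨
    x ⊙ z ⊕ (x ⊕ z) ⊙ y              ∎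
    where open ≡-Reasoning

  ⊕-⊙-goodPair : ∀ x y → GoodPair A (x ⊕ y) (x ⊙ y)
  ⊕-⊙-goodPair x y = ⊕-absorbs-⊙ , ⊙-absorbs-⊕
    where
    open ≡-Reasoning
    ⊙-absorbs-⊕ : (x ⊕ y) ⊙ (x ⊙ y) ≡ x ⊙ y
    ⊙-absorbs-⊕ = begin
      (x ⊕ y) ⊙ (x ⊙ y)                ≡⟨ cong ((x ⊕ y) ⊙_) (⊕-identityʳ _) ⟨
      (x ⊕ y) ⊙ (x ⊙ y ⊕ 𝟘)            ≡⟨ ∨-identityʳ _ ⟨
      (x ⊕ y) ⊙ (x ⊙ y ⊕ 𝟘) ∨ 𝟘        ≡⟨ ax3 x y 𝟘 ⟨
      x ⊙ y ⊕ 𝟘                        ≡⟨ ⊕-identityʳ _ ⟩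
      x ⊙ y                            ∎
    ⊕-absorbs-⊙ : (x ⊕ y) ⊕ x ⊙ y ≡ x ⊕ y
    ⊕-absorbs-⊙ = begin
      (x ⊕ y) ⊕ x ⊙ y                  ≡⟨ ⊕-comm _ _ ⟩
      x ⊙ y ⊕ (x ⊕ y)                  ≡⟨ cong (x ⊙ y ⊕_) (⊙-identityʳ _) ⟨
      x ⊙ y ⊕ (x ⊕ y) ⊙ 𝟙              ≡⟨ 𝟙-maximum _ ⟩
      (x ⊙ y ⊕ (x ⊕ y) ⊙ 𝟙) ∧ 𝟙        ≡⟨ ax4 x y 𝟙 ⟨
      (x ⊕ y) ⊙ 𝟙                      ≡⟨ ⊙-identityʳ _ ⟩
      x ⊕ y                            ∎

  𝟙-goodPair : ∀ x → GoodPair A 𝟙 x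
  𝟙-goodPair x = ⊕-zeroˡ x , ⊙-identityˡ x

  module _ {u v : Carrier} (uv-good : GoodPair A u v) where

    private
      specialise : (F : Carrier → Carrier → Carrier) → F u v ≡ F (u ⊕ v) (u ⊙ v)
      specialise F = cong₂ F (sym (proj₁ uv-good)) (sym (proj₂ uv-good))

    goodPair-ax1 : ∀ x → u ⊙ (v ⊕ x) ≡ u ⊙ (v ⊕ x) ⊕ v ⊙ x
    goodPair-ax1 x = trans (specialise λ a b → a ⊙ (b ⊕ x)) (ax1 u v x)

    goodPair-ax2 : ∀ x → v ⊕ u ⊙ x ≡ (u ⊕ v ⊙ x) ⊙ (v ⊕ x)
    goodPair-ax2 x = trans (specialise λ a b → b ⊕ a ⊙ x) (ax2 u v x)

    goodPair-ax3 : ∀ x → v ⊕ x ≡ u ⊙ (v ⊕ x) ∨ x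
    goodPair-ax3 x = trans (specialise λ _ b → b ⊕ x)
      (trans (ax3 u v x) (sym (specialise λ a b → a ⊙ (b ⊕ x) ∨ x)))

    goodPair-ax4 : ∀ x → u ⊙ x ≡ (v ⊕ u ⊙ x) ∧ x
    goodPair-ax4 x = trans (specialise λ a _ → a ⊙ x)
      (trans (ax4 u v x) (sym (specialise λ a b → (b ⊕ a ⊙ x) ∧ x)))

    goodPair-exchange : ∀ x → u ⊙ (v ⊕ x) ≡ v ⊕ u ⊙ x
    goodPair-exchange x = sym (begin
      v ⊕ u ⊙ x                        ≡⟨ R≤v⊕x ⟩
      (v ⊕ u ⊙ x) ∧ (v ⊕ x)            ≡⟨ cong ((v ⊕ u ⊙ x) ∧_) (goodPair-ax3 x) ⟩
      (v ⊕ u ⊙ x) ∧ (u ⊙ (v ⊕ x) ∨ x)  ≡⟨ ∧-distribˡ-∨ _ _ x ⟩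
      ((v ⊕ u ⊙ x) ∧ u ⊙ (v ⊕ x)) ∨ ((v ⊕ u ⊙ x) ∧ x)
        ≡⟨ cong₂ _∨_ (trans (∧-comm _ _) (sym L≤R)) (sym (goodPair-ax4 x)) ⟩
      u ⊙ (v ⊕ x) ∨ u ⊙ x              ≡⟨ trans (∨-comm _ _) (x≤y⇒x∨y≡y u⊙x≤L) ⟩
      u ⊙ (v ⊕ x)                      ∎)
      where
      open ≡-Reasoning
      L≤R : u ⊙ (v ⊕ x) ≤ v ⊕ u ⊙ x
      L≤R = ≤-trans (⊙-monoˡ-≤ (v ⊕ x) (x≤x⊕y u (v ⊙ x))) (≤-reflexive (sym (goodPair-ax2 x)))
      R≤v⊕x : v ⊕ u ⊙ x ≤ v ⊕ x
      R≤v⊕x = ⊕-monoʳ-≤ v (x⊙y≤y u x)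
      u⊙x≤L : u ⊙ x ≤ u ⊙ (v ⊕ x)
      u⊙x≤L = ⊙-monoʳ-≤ u (y≤x⊕y v x)

  goodPair-monoˡ : ∀ {P Q Y} → GoodPair A P Q → P ≤ Y → GoodPair A Y Q
  goodPair-monoˡ {P} {Q} {Y} PQ-good P≤Y = Y⊕Q≡Y , Y⊙Q≡Q
    where
    Y⊙Q≡Q : Y ⊙ Q ≡ Q
    Y⊙Q≡Q = ≤-antisym (x⊙y≤y Y Q) (subst (_≤ Y ⊙ Q) (proj₂ PQ-good) (⊙-monoˡ-≤ Q P≤Y))
    P⊙[Q⊕Y]≤Y : P ⊙ (Q ⊕ Y) ≤ Y
    P⊙[Q⊕Y]≤Y = begin
      P ⊙ (Q ⊕ Y)                      ≡⟨ goodPair-exchange PQ-good Y ⟩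
      Q ⊕ P ⊙ Y                        ≤⟨ ⊕-monoʳ-≤ Q (x⊙y≤x P Y) ⟩
      Q ⊕ P                            ≡⟨ trans (⊕-comm Q P) (proj₁ PQ-good) ⟩
      P                                ≤⟨ P≤Y ⟩
      Y                                ∎
      where open ≤-Reasoning
    Y⊕Q≡Y : Y ⊕ Q ≡ Y
    Y⊕Q≡Y = trans (⊕-comm Y Q) (trans (goodPair-ax3 PQ-good Y) (x≤y⇒x∨y≡y P⊙[Q⊕Y]≤Y))

  goodPair-expand : ∀ {P Q} → GoodPair A P Q →
    ∀ t r → (P ⊕ t) ⊙ ((Q ⊕ P ⊙ t) ⊕ r) ≡ P ⊙ (Q ⊕ r) ⊕ (P ⊕ r) ⊙ t
  goodPair-expand {P} {Q} PQ-good t r = begin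
    (P ⊕ t) ⊙ ((Q ⊕ P ⊙ t) ⊕ r)      ≡⟨ cong ((P ⊕ t) ⊙_) (⊕.xy∙z≈y∙xz Q _ r) ⟩
    (P ⊕ t) ⊙ (P ⊙ t ⊕ (Q ⊕ r))      ≡⟨ goodPair-exchange (⊕-⊙-goodPair P t) (Q ⊕ r) ⟩
    P ⊙ t ⊕ (P ⊕ t) ⊙ (Q ⊕ r)        ≡⟨ cong (P ⊙ t ⊕_) (goodPair-exchange [P⊕t]Q-good r) ⟩
    P ⊙ t ⊕ (Q ⊕ (P ⊕ t) ⊙ r)        ≡⟨ ⊕.x∙yz≈y∙xz _ Q _ ⟩
    Q ⊕ (P ⊙ t ⊕ (P ⊕ t) ⊙ r)        ≡⟨ cong (Q ⊕_) (⊙-⊕-mixed-comm P t r) ⟩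
    Q ⊕ (P ⊙ r ⊕ (P ⊕ r) ⊙ t)        ≡⟨ ⊕-assoc Q _ _ ⟨
    (Q ⊕ P ⊙ r) ⊕ (P ⊕ r) ⊙ t        ≡⟨ cong (_⊕ (P ⊕ r) ⊙ t) (goodPair-exchange PQ-good r) ⟨
    P ⊙ (Q ⊕ r) ⊕ (P ⊕ r) ⊙ t        ∎
    where
    open ≡-Reasoning
    [P⊕t]Q-good : GoodPair A (P ⊕ t) Q
    [P⊕t]Q-good = goodPair-monoˡ PQ-good (x≤x⊕y P t)

  -- One step along the partial products of (p + q)ₙ: Y is the product of its first j + 1
  -- factors, the last one being P ⊕ r′, and Z the product of the first j factors of (p + q)ₙ₋₁.
  module _ {P Q r r′ Y Z : Carrier}
           (PQ-good : GoodPair A P Q) (rr′-good : GoodPair A r r′)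
           (P≤Y : P ≤ Y) (Y≤P⊕r′ : Y ≤ P ⊕ r′) (ZY-good : GoodPair A Z Y) where

    private
      r′⊕r≡r : r′ ⊕ r ≡ r
      r′⊕r≡r = trans (⊕-comm r′ r) (proj₁ rr′-good)

      Y⊕r≡P⊕r : Y ⊕ r ≡ P ⊕ r
      Y⊕r≡P⊕r = ≤-antisym Y⊕r≤P⊕r (⊕-monoˡ-≤ r P≤Y)
        where
        open ≤-Reasoning
        Y⊕r≤P⊕r : Y ⊕ r ≤ P ⊕ r
        Y⊕r≤P⊕r = begin
          Y ⊕ r                        ≤⟨ ⊕-monoˡ-≤ r Y≤P⊕r′ ⟩
          (P ⊕ r′) ⊕ r                 ≡⟨ trans (⊕-assoc P r′ r) (cong (P ⊕_) r′⊕r≡r) ⟩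
          P ⊕ r                        ∎

      P⊙y⊕r≡Y⊙y⊕r : ∀ y → P ⊙ y ⊕ r ≡ Y ⊙ y ⊕ r
      P⊙y⊕r≡Y⊙y⊕r y = ≤-antisym (⊕-monoˡ-≤ r (⊙-monoˡ-≤ y P≤Y)) Y⊙y⊕r≤P⊙y⊕r
        where
        open ≤-Reasoning
        Y⊙y⊕r≤P⊙y⊕r : Y ⊙ y ⊕ r ≤ P ⊙ y ⊕ r
        Y⊙y⊕r≤P⊙y⊕r = begin
          Y ⊙ y ⊕ r                    ≤⟨ ⊕-monoˡ-≤ r (⊙-monoˡ-≤ y Y≤P⊕r′) ⟩
          (P ⊕ r′) ⊙ y ⊕ r             ≡⟨ cong (_⊕ r) (⊙-comm _ y) ⟩
          y ⊙ (P ⊕ r′) ⊕ r             ≤⟨ ⊕-monoˡ-≤ r (⊙-⊕-weakDistrib y P r′) ⟩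
          (y ⊙ P ⊕ r′) ⊕ r             ≡⟨ trans (⊕-assoc _ r′ r) (cong₂ _⊕_ (⊙-comm y P) r′⊕r≡r) ⟩
          P ⊙ y ⊕ r                    ∎

      YQ-good : GoodPair A Y Q
      YQ-good = goodPair-monoˡ PQ-good P≤Y

    partialProduct-step : ∀ y →
      (Y ⊕ Z ⊙ y) ⊙ ((Q ⊕ P ⊙ y) ⊕ r) ≡ Y ⊙ (Q ⊕ r) ⊕ Z ⊙ (P ⊕ r) ⊙ y
    partialProduct-step y = begin
      (Y ⊕ Z ⊙ y) ⊙ ((Q ⊕ P ⊙ y) ⊕ r)        ≡⟨ cong ((Y ⊕ Z ⊙ y) ⊙_) Q⊕P⊙y⊕r≡Q⊕Y⊙y⊕r ⟩
      (Y ⊕ Z ⊙ y) ⊙ ((Q ⊕ Y ⊙ y) ⊕ r)        ≡⟨ cong (λ w → (Y ⊕ Z ⊙ y) ⊙ ((Q ⊕ w) ⊕ r)) Y⊙y≡Y⊙Z⊙y ⟩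
      (Y ⊕ Z ⊙ y) ⊙ ((Q ⊕ Y ⊙ (Z ⊙ y)) ⊕ r)  ≡⟨ goodPair-expand YQ-good (Z ⊙ y) r ⟩
      Y ⊙ (Q ⊕ r) ⊕ (Y ⊕ r) ⊙ (Z ⊙ y)        ≡⟨ cong (Y ⊙ (Q ⊕ r) ⊕_) [Y⊕r]⊙Z⊙y≡Z⊙[P⊕r]⊙y ⟩
      Y ⊙ (Q ⊕ r) ⊕ Z ⊙ (P ⊕ r) ⊙ y          ∎
      where
      open ≡-Reasoning
      Q⊕P⊙y⊕r≡Q⊕Y⊙y⊕r : (Q ⊕ P ⊙ y) ⊕ r ≡ (Q ⊕ Y ⊙ y) ⊕ r
      Q⊕P⊙y⊕r≡Q⊕Y⊙y⊕r = trans (⊕-assoc Q _ r) (trans (cong (Q ⊕_) (P⊙y⊕r≡Y⊙y⊕r y)) (sym (⊕-assoc Q _ r)))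
      Y⊙y≡Y⊙Z⊙y : Y ⊙ y ≡ Y ⊙ (Z ⊙ y)
      Y⊙y≡Y⊙Z⊙y = trans (cong (_⊙ y) (sym (proj₂ ZY-good))) (⊙.xy∙z≈y∙xz Z Y y)
      [Y⊕r]⊙Z⊙y≡Z⊙[P⊕r]⊙y : (Y ⊕ r) ⊙ (Z ⊙ y) ≡ Z ⊙ (P ⊕ r) ⊙ y
      [Y⊕r]⊙Z⊙y≡Z⊙[P⊕r]⊙y = trans (⊙.x∙yz≈yx∙z _ Z y) (cong (λ w → Z ⊙ w ⊙ y) Y⊕r≡P⊕r)

    partialProduct-step-good : GoodPair A (Z ⊙ (P ⊕ r)) (Y ⊙ (Q ⊕ r))
    partialProduct-step-good = ⊕-absorbs , ⊙-absorbs
      where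
      open ≡-Reasoning
      Z⊙[P⊕r]≡Y⊕Z⊙r : Z ⊙ (P ⊕ r) ≡ Y ⊕ Z ⊙ r
      Z⊙[P⊕r]≡Y⊕Z⊙r = trans (cong (Z ⊙_) (sym Y⊕r≡P⊕r)) (goodPair-exchange ZY-good r)
      ⊕-absorbs : Z ⊙ (P ⊕ r) ⊕ Y ⊙ (Q ⊕ r) ≡ Z ⊙ (P ⊕ r)
      ⊕-absorbs = begin
        Z ⊙ (P ⊕ r) ⊕ Y ⊙ (Q ⊕ r)      ≡⟨ cong₂ _⊕_ Z⊙[P⊕r]≡Y⊕Z⊙r (goodPair-exchange YQ-good r) ⟩
        (Y ⊕ Z ⊙ r) ⊕ (Q ⊕ Y ⊙ r)      ≡⟨ ⊕-assoc _ Q _ ⟨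
        ((Y ⊕ Z ⊙ r) ⊕ Q) ⊕ Y ⊙ r      ≡⟨ cong (_⊕ Y ⊙ r) (⊕.xy∙z≈xz∙y Y _ Q) ⟩
        ((Y ⊕ Q) ⊕ Z ⊙ r) ⊕ Y ⊙ r      ≡⟨ cong (λ w → (w ⊕ Z ⊙ r) ⊕ Y ⊙ r) (proj₁ YQ-good) ⟩
        (Y ⊕ Z ⊙ r) ⊕ Y ⊙ r            ≡⟨ cong (_⊕ Y ⊙ r) (goodPair-exchange ZY-good r) ⟨
        Z ⊙ (Y ⊕ r) ⊕ Y ⊙ r            ≡⟨ goodPair-ax1 ZY-good r ⟨
        Z ⊙ (Y ⊕ r)                    ≡⟨ cong (Z ⊙_) Y⊕r≡P⊕r ⟩
        Z ⊙ (P ⊕ r)                    ∎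
      ⊙-absorbs : Z ⊙ (P ⊕ r) ⊙ (Y ⊙ (Q ⊕ r)) ≡ Y ⊙ (Q ⊕ r)
      ⊙-absorbs = begin
        Z ⊙ (P ⊕ r) ⊙ (Y ⊙ (Q ⊕ r))    ≡⟨ ⊙.interchange Z _ Y _ ⟩
        Z ⊙ Y ⊙ ((P ⊕ r) ⊙ (Q ⊕ r))    ≡⟨ cong (_⊙ ((P ⊕ r) ⊙ (Q ⊕ r))) (proj₂ ZY-good) ⟩
        Y ⊙ ((P ⊕ r) ⊙ (Q ⊕ r))        ≡⟨ cong (λ w → Y ⊙ (w ⊙ (Q ⊕ r))) Y⊕r≡P⊕r ⟨
        Y ⊙ ((Y ⊕ r) ⊙ (Q ⊕ r))        ≡⟨ ⊙.x∙yz≈y∙xz Y _ _ ⟩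
        (Y ⊕ r) ⊙ (Y ⊙ (Q ⊕ r))        ≡⟨ cong ((Y ⊕ r) ⊙_) (goodPair-exchange YQ-good r) ⟩
        (Y ⊕ r) ⊙ (Q ⊕ Y ⊙ r)          ≡⟨ goodPair-exchange (goodPair-monoˡ YQ-good (x≤x⊕y Y r)) (Y ⊙ r) ⟩
        Q ⊕ (Y ⊕ r) ⊙ (Y ⊙ r)          ≡⟨ cong (Q ⊕_) (proj₂ (⊕-⊙-goodPair Y r)) ⟩
        Q ⊕ Y ⊙ r                      ≡⟨ goodPair-exchange YQ-good r ⟨
        Y ⊙ (Q ⊕ r)                    ∎

  GoodChain : (ℕ → Carrier) → Set ℓ
  GoodChain s = ∀ n → GoodPair A (s n) (s (suc n))

  infixr 5 _◂_
  _◂_ : Carrier → (ℕ → Carrier) → ℕ → Carrier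
  (x ◂ s) zero    = x
  (x ◂ s) (suc n) = s n

  zeros : ℕ → Carrier
  zeros _ = 𝟘

  singleton : Carrier → ℕ → Carrier
  singleton y = y ◂ zeros

  prodBelow : (ℕ → Carrier) → ℕ → Carrier
  prodBelow f = 𝟙 ◂ prodUpTo A f

  infixl 6 _+ₛ_
  _+ₛ_ : (ℕ → Carrier) → (ℕ → Carrier) → ℕ → Carrier
  _+ₛ_ = seqSum A

  prodUpTo-goodChain : ∀ {s} → GoodChain s → ∀ k → prodUpTo A s k ≡ s k
  prodUpTo-goodChain s-good zero    = refl
  prodUpTo-goodChain {s} s-good (suc k) =
    trans (cong (_⊙ s (suc k)) (prodUpTo-goodChain s-good k)) (proj₂ (s-good k))

  prodUpTo-≤-last : ∀ f k → prodUpTo A f k ≤ f k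
  prodUpTo-≤-last f zero    = ≤-refl
  prodUpTo-≤-last f (suc k) = x⊙y≤y _ _

  prodUpTo-mono-≤ : ∀ {f g} → (∀ i → f i ≤ g i) → ∀ k → prodUpTo A f k ≤ prodUpTo A g k
  prodUpTo-mono-≤ f≤g zero    = f≤g 0
  prodUpTo-mono-≤ f≤g (suc k) = ⊙-mono-≤ (prodUpTo-mono-≤ f≤g k) (f≤g (suc k))

  prodUpTo-cong : ∀ {f g} k → (∀ i → i ≤ℕ k → f i ≡ g i) → prodUpTo A f k ≡ prodUpTo A g k
  prodUpTo-cong zero    f≡g = f≡g 0 z≤n
  prodUpTo-cong (suc k) f≡g =
    cong₂ _⊙_ (prodUpTo-cong k (λ i i≤k → f≡g i (ℕ.m≤n⇒m≤1+n i≤k))) (f≡g (suc k) ℕ.≤-refl)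

  prodUpTo-suc : ∀ f n → prodUpTo A f (suc n) ≡ f 0 ⊙ prodUpTo A (λ i → f (suc i)) n
  prodUpTo-suc f zero    = refl
  prodUpTo-suc f (suc n) = trans (cong (_⊙ f (suc (suc n))) (prodUpTo-suc f n)) (⊙-assoc _ _ _)

  prodUpTo-reverse : ∀ f n → prodUpTo A (λ i → f (n ∸ i)) n ≡ prodUpTo A f n
  prodUpTo-reverse f zero    = refl
  prodUpTo-reverse f (suc n) = trans (prodUpTo-suc (λ i → f (suc n ∸ i)) n)
    (trans (cong (f (suc n) ⊙_) (prodUpTo-reverse f n)) (⊙-comm _ _))

  prodBelow-suc : ∀ f j → prodBelow f (suc j) ≡ prodBelow f j ⊙ f j
  prodBelow-suc f zero    = sym (⊙-identityˡ (f 0))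
  prodBelow-suc f (suc j) = refl

  +ₛ-congˡ : ∀ {s s′} t → s ≗ s′ → s +ₛ t ≗ s′ +ₛ t
  +ₛ-congˡ t s≗s′ n = prodUpTo-cong n (λ i _ → cong (_⊕ t (n ∸ i)) (s≗s′ i))

  +ₛ-identityˡ : ∀ {s} → GoodChain s → zeros +ₛ s ≗ s
  +ₛ-identityˡ {s} s-good n = begin
    prodUpTo A (λ i → 𝟘 ⊕ s (n ∸ i)) n   ≡⟨ prodUpTo-cong n (λ i _ → ⊕-identityˡ (s (n ∸ i))) ⟩
    prodUpTo A (λ i → s (n ∸ i)) n       ≡⟨ prodUpTo-reverse s n ⟩
    prodUpTo A s n                       ≡⟨ prodUpTo-goodChain s-good n ⟩
    s n                                  ∎
    where open ≡-Reasoning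

  addSingleton : (ℕ → Carrier) → Carrier → ℕ → Carrier
  addSingleton s y n = s n ⊕ (𝟙 ◂ s) n ⊙ y

  +ₛ-singletonʳ : ∀ {s} → GoodChain s → ∀ y → s +ₛ singleton y ≗ addSingleton s y
  +ₛ-singletonʳ {s} s-good y zero    = cong (s 0 ⊕_) (sym (⊙-identityˡ y))
  +ₛ-singletonʳ {s} s-good y (suc k) = begin
    prodUpTo A (λ i → s i ⊕ singleton y (suc k ∸ i)) k ⊙ (s (suc k) ⊕ singleton y (k ∸ k))
      ≡⟨ cong₂ _⊙_ (prodUpTo-cong k earlier-terms) (cong (λ i → s (suc k) ⊕ singleton y i) (ℕ.n∸n≡0 k)) ⟩
    prodUpTo A s k ⊙ (s (suc k) ⊕ y)    ≡⟨ cong (_⊙ (s (suc k) ⊕ y)) (prodUpTo-goodChain s-good k) ⟩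
    s k ⊙ (s (suc k) ⊕ y)               ≡⟨ goodPair-exchange (s-good k) y ⟩
    s (suc k) ⊕ s k ⊙ y                 ∎
    where
    open ≡-Reasoning
    earlier-terms : ∀ i → i ≤ℕ k → s i ⊕ singleton y (suc k ∸ i) ≡ s i
    earlier-terms i i≤k =
      trans (cong (λ j → s i ⊕ singleton y j) (ℕ.+-∸-assoc 1 i≤k)) (⊕-identityʳ (s i))

  tail-+ₛ-singleton-head : ∀ {p} → GoodChain p → (λ i → p (suc i)) +ₛ singleton (p 0) ≗ p
  tail-+ₛ-singleton-head {p} p-good m =
    trans (+ₛ-singletonʳ (λ n → p-good (suc n)) (p 0) m) (reassemble m)
    where
    p₀⊙p≡p : ∀ k → p 0 ⊙ p (suc k) ≡ p (suc k)
    p₀⊙p≡p k = begin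
      p 0 ⊙ p (suc k)                           ≡⟨ cong (p 0 ⊙_) (prodUpTo-goodChain (λ n → p-good (suc n)) k) ⟨
      p 0 ⊙ prodUpTo A (λ i → p (suc i)) k      ≡⟨ prodUpTo-suc p k ⟨
      prodUpTo A p (suc k)                      ≡⟨ prodUpTo-goodChain p-good (suc k) ⟩
      p (suc k)                                 ∎
      where open ≡-Reasoning
    reassemble : ∀ m → addSingleton (λ i → p (suc i)) (p 0) m ≡ p m
    reassemble zero    = trans (cong (p 1 ⊕_) (⊙-identityˡ (p 0))) (trans (⊕-comm _ _) (proj₁ (p-good 0)))
    reassemble (suc k) = trans (cong (p (suc (suc k)) ⊕_) (trans (⊙-comm _ _) (p₀⊙p≡p k)))
                               (trans (⊕-comm _ _) (proj₁ (p-good (suc k))))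

  module _ {p q : ℕ → Carrier} (p-good : GoodChain p) (q-good : GoodChain q) where

    private
      term : (ℕ → Carrier) → ℕ → ℕ → Carrier
      term s n i = s i ⊕ q (n ∸ i)

      partial : ℕ → ℕ → Carrier
      partial n = prodUpTo A (term p n)

      previous : ℕ → ℕ → Carrier
      previous n = prodBelow (term p (n ∸ 1))

      p≤partial : ∀ n j → p j ≤ partial n j
      p≤partial n j = subst (_≤ partial n j) (prodUpTo-goodChain p-good j)
        (prodUpTo-mono-≤ (λ i → x≤x⊕y (p i) _) j)

      partial≤last : ∀ m j → j ≤ℕ m → partial (suc m) j ≤ p j ⊕ q (suc (m ∸ j))
      partial≤last m j j≤m = subst (λ k → partial (suc m) j ≤ p j ⊕ q k) (ℕ.+-∸-assoc 1 j≤m)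
        (prodUpTo-≤-last (term p (suc m)) j)

      previous-partial-good : ∀ n j → j ≤ℕ n → GoodPair A (previous n j) (partial n j)
      previous-partial-good n       zero    _         = 𝟙-goodPair _
      previous-partial-good (suc m) (suc j) (s≤s j≤m) =
        subst (λ z → GoodPair A z (partial (suc m) (suc j))) (sym (prodBelow-suc (term p m) j))
          (partialProduct-step-good (p-good j) (q-good (m ∸ j)) (p≤partial (suc m) j) (partial≤last m j j≤m)
            (previous-partial-good (suc m) j (ℕ.m≤n⇒m≤1+n j≤m)))

      addSingleton-partial : ∀ y n j → j ≤ℕ n →
        prodUpTo A (term (addSingleton p y) n) j ≡ partial n j ⊕ previous n j ⊙ y
      addSingleton-partial y n       zero    _         = ⊕.xy∙z≈xz∙y (p 0) _ (q n)
      addSingleton-partial y (suc m) (suc j) (s≤s j≤m) = begin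
        prodUpTo A (term (addSingleton p y) (suc m)) j ⊙ term (addSingleton p y) (suc m) (suc j)
          ≡⟨ cong (_⊙ term (addSingleton p y) (suc m) (suc j)) (addSingleton-partial y (suc m) j j≤1+m) ⟩
        (partial (suc m) j ⊕ previous (suc m) j ⊙ y) ⊙ ((p (suc j) ⊕ p j ⊙ y) ⊕ q (m ∸ j))
          ≡⟨ partialProduct-step (p-good j) (q-good (m ∸ j)) (p≤partial (suc m) j) (partial≤last m j j≤m)
               (previous-partial-good (suc m) j j≤1+m) y ⟩
        partial (suc m) (suc j) ⊕ previous (suc m) j ⊙ (p j ⊕ q (m ∸ j)) ⊙ y
          ≡⟨ cong (λ z → partial (suc m) (suc j) ⊕ z ⊙ y) (prodBelow-suc (term p m) j) ⟨
        partial (suc m) (suc j) ⊕ previous (suc m) (suc j) ⊙ y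
          ∎
        where
        open ≡-Reasoning
        j≤1+m : j ≤ℕ suc m
        j≤1+m = ℕ.m≤n⇒m≤1+n j≤m

      previous-last : ∀ n → previous n n ≡ (𝟙 ◂ p +ₛ q) n
      previous-last zero    = refl
      previous-last (suc m) = refl

    +ₛ-goodChain : GoodChain (p +ₛ q)
    +ₛ-goodChain m = previous-partial-good (suc m) (suc m) ℕ.≤-refl

    +ₛ-addSingletonˡ : ∀ y → addSingleton p y +ₛ q ≗ addSingleton (p +ₛ q) y
    +ₛ-addSingletonˡ y n = trans (addSingleton-partial y n n ℕ.≤-refl)
      (cong (λ z → (p +ₛ q) n ⊕ z ⊙ y) (previous-last n))

  +ₛ-singleton-swap : ∀ {p q} → GoodChain p → GoodChain q →
    ∀ y → p +ₛ singleton y +ₛ q ≗ p +ₛ q +ₛ singleton y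
  +ₛ-singleton-swap {p} {q} p-good q-good y n = begin
    (p +ₛ singleton y +ₛ q) n      ≡⟨ +ₛ-congˡ q (+ₛ-singletonʳ p-good y) n ⟩
    (addSingleton p y +ₛ q) n      ≡⟨ +ₛ-addSingletonˡ p-good q-good y n ⟩
    addSingleton (p +ₛ q) y n      ≡⟨ +ₛ-singletonʳ (+ₛ-goodChain p-good q-good) y n ⟨
    (p +ₛ q +ₛ singleton y) n      ∎
    where open ≡-Reasoning

  +ₛ-assoc : ∀ N {a} → GoodChain a → (∀ i → N ≤ℕ i → a i ≡ 𝟘) →
    ∀ {b c} → GoodChain b → GoodChain c → a +ₛ b +ₛ c ≗ a +ₛ (b +ₛ c)
  +ₛ-assoc zero {a} _ a-vanishes {b} {c} b-good c-good n = begin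
    (a +ₛ b +ₛ c) n              ≡⟨ +ₛ-congˡ c (+ₛ-congˡ b a≗zeros) n ⟩
    (zeros +ₛ b +ₛ c) n          ≡⟨ +ₛ-congˡ c (+ₛ-identityˡ b-good) n ⟩
    (b +ₛ c) n                   ≡⟨ +ₛ-identityˡ (+ₛ-goodChain b-good c-good) n ⟨
    (zeros +ₛ (b +ₛ c)) n        ≡⟨ +ₛ-congˡ (b +ₛ c) a≗zeros n ⟨
    (a +ₛ (b +ₛ c)) n            ∎
    where
    open ≡-Reasoning
    a≗zeros : a ≗ zeros
    a≗zeros i = a-vanishes i z≤n
  +ₛ-assoc (suc N) {a} a-good a-vanishes {b} {c} b-good c-good n = begin
    (a +ₛ b +ₛ c) n                       ≡⟨ +ₛ-congˡ c (+ₛ-congˡ b (λ i → sym (tail-+ₛ-singleton-head a-good i))) n ⟩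
    (a′ +ₛ singleton a₀ +ₛ b +ₛ c) n      ≡⟨ +ₛ-congˡ c (+ₛ-singleton-swap a′-good b-good a₀) n ⟩
    (a′ +ₛ b +ₛ singleton a₀ +ₛ c) n      ≡⟨ +ₛ-singleton-swap (+ₛ-goodChain a′-good b-good) c-good a₀ n ⟩
    (a′ +ₛ b +ₛ c +ₛ singleton a₀) n      ≡⟨ +ₛ-congˡ (singleton a₀) (+ₛ-assoc N a′-good a′-vanishes b-good c-good) n ⟩
    (a′ +ₛ (b +ₛ c) +ₛ singleton a₀) n    ≡⟨ +ₛ-singleton-swap a′-good (+ₛ-goodChain b-good c-good) a₀ n ⟨
    (a′ +ₛ singleton a₀ +ₛ (b +ₛ c)) n    ≡⟨ +ₛ-congˡ (b +ₛ c) (tail-+ₛ-singleton-head a-good) n ⟩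
    (a +ₛ (b +ₛ c)) n                     ∎
    where
    open ≡-Reasoning
    a₀ : Carrier
    a₀ = a 0
    a′ : ℕ → Carrier
    a′ i = a (suc i)
    a′-good : GoodChain a′
    a′-good i = a-good (suc i)
    a′-vanishes : ∀ i → N ≤ℕ i → a′ i ≡ 𝟘
    a′-vanishes i N≤i = a-vanishes (suc i) (s≤s N≤i)

proposition7p20 : {ℓ : Level} (A : MVMonoidalAlgebra ℓ) (a b c : GoodSeq A) →
    _≗ₛ_ A (seqSum A (seqSum A (GoodSeq.seq a) (GoodSeq.seq b)) (GoodSeq.seq c))
    (seqSum A (GoodSeq.seq a) (seqSum A (GoodSeq.seq b) (GoodSeq.seq c)))
proposition7p20 A (mkGoodSeq _ (a-good , N , a-vanishes)) (mkGoodSeq _ (b-good , _)) (mkGoodSeq _ (c-good , _)) =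
  +ₛ-assoc A N a-good a-vanishes b-good c-good
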